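{- Let $0\le\alpha\le1$ and let $S\subseteq\mathbb{F}_2^n$ with $|S|\ge\alpha 2^n$. Then there exists $a\in\mathbb{F}_2^n$ such that the translate $S+\{a\}=\{s+a: s\in S\}$ contains a chain $C$ (with respect to the partial order $\le$ below) of size $|C|\ge\alpha n$.
   Context: Partial order on $\mathbb{F}_2^n$: for $x,y\in\mathbb{F}_2^n$, $x\le y$ iff $x_i\le y_i$ (as elements of $\{0,1\}$) for every coordinate $i$. A chain is a set of pairwise comparable elements. Addition is coordinatewise in $\mathbb{F}_2$.
   Formalization: The parameter α ranges over the rationals between 0 and 1. -}

module Defs where

open import Data.Nat as ℕ using (ℕ; _^_)
open import Data.Bool using (Bool; _xor_)
import Data.Bool as Bool
open import Data.Fin using (Fin)
open import Data.Vec using (Vec; lookup; zipWith)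
open import Data.List using (List)
open import Data.List.Membership.Propositional using (_∈_)
open import Data.Product using (∃; _×_)
open import Data.Sum using (_⊎_)
open import Data.Integer using (+_)
open import Data.Rational using (ℚ; _/_)
open import Relation.Binary.PropositionalEquality using (_≡_)

F₂^ : ℕ → Set
F₂^ n = Vec Bool n

_⊕_ : ∀ {n} → F₂^ n → F₂^ n → F₂^ n
_⊕_ = zipWith _xor_

_≼_ : ∀ {n} → F₂^ n → F₂^ n → Set
x ≼ y = ∀ i → lookup x i Bool.≤ lookup y i

_∈Translate_+_ : ∀ {n} → F₂^ n → List (F₂^ n) → F₂^ n → Set
c ∈Translate S + a = ∃ λ s → s ∈ S × c ≡ s ⊕ a

IsChain : ∀ {n} → List (F₂^ n) → Set
IsChain C = ∀ {x y} → x ∈ C → y ∈ C → (x ≼ y) ⊎ (y ≼ x)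

ℕtoℚ : ℕ → ℚ
ℕtoℚ k = + k / 1

-- Fix the maximal chain 0 < e₁ < e₁+e₂ < … < e₁+…+eₙ of n + 1 elements. Every c
-- in it lies in S + a for exactly |S| of the 2ⁿ translates a, so summed over all
-- a the chains (maximal chain) ∩ (S + a) have total size (n + 1)|S|. Some
-- translate therefore meets the maximal chain in at least (n + 1)|S| / 2ⁿ ≥ α(n + 1)
-- elements, and a subset of a chain is a chain.
module Submission where

open import Defs
open import Algebra.Bundles using (CommutativeMonoid)
import Algebra.Properties.CommutativeSemigroup as CommSemigroupProperties
open import Data.Bool as Bool using (true; false; _xor_)
open import Data.Bool.Properties using (xor-assoc; xor-same; xor-identityʳ; ≤-minimum)
import Data.Fin as Fin
open import Data.Integer using (+_)
import Data.Integer as ℤ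
import Data.Integer.Properties as ℤ
open import Data.List using (List; []; _∷_; length; map; filter)
open import Data.List.Properties using (length-map)
open import Data.List.Membership.Propositional using (_∈_; _∉_)
open import Data.List.Membership.Propositional.Properties using (∈-map⁻)
import Data.List.Membership.DecPropositional as DecMembership
open import Data.List.Relation.Binary.Subset.Propositional using (_⊆_)
open import Data.List.Relation.Binary.Subset.Propositional.Properties using (filter-⊆)
open import Data.List.Relation.Unary.All as All using (All; [])
open import Data.List.Relation.Unary.All.Properties using (All¬⇒¬Any; all-filter; map⁺)
open import Data.List.Relation.Unary.AllPairs using ([]; _∷_)
open import Data.List.Relation.Unary.Any using (here; there; tail)
open import Data.List.Relation.Unary.Unique.Propositional using (Unique)
import Data.List.Relation.Unary.Unique.Propositional.Properties as Unique
open import Data.Nat as ℕ using (ℕ; zero; suc; _+_; _^_; NonZero)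
import Data.Nat.Properties as ℕ
import Data.Nat.Coprimality as Coprimality
open import Data.Nat.Tactic.RingSolver using (solve-∀)
open import Data.Product using (Σ; ∃-syntax; _×_; _,_)
open import Data.Rational as ℚ using (ℚ; 0ℚ; 1ℚ; _≤_; _*_; mkℚ; Positive; NonNegative)
import Data.Rational.Properties as ℚ
open import Data.Sum using (inj₁; inj₂)
open import Data.Vec using ([]; _∷_; replicate)
import Data.Vec.Properties as Vec
open import Function using (_∘_)
open import Level using (Level)
open import Relation.Binary.Definitions using (DecidableEquality)
open import Relation.Binary.PropositionalEquality
open import Relation.Nullary using (Dec; yes; no; ¬_; contradiction)
open import Relation.Unary using (Pred; Decidable)

open CommSemigroupProperties ℕ.+-commutativeSemigroup
  using () renaming (interchange to +-interchange)
open CommSemigroupProperties (CommutativeMonoid.commutativeSemigroup ℚ.*-1-commutativeMonoid)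
  using (xy∙z≈xz∙y)

private
  variable
    ℓ ℓ′ : Level
    n : ℕ

_≟_ : DecidableEquality (F₂^ n)
_≟_ = Vec.≡-dec Bool._≟_

_∈?_ : (x : F₂^ n) (S : List (F₂^ n)) → Dec (x ∈ S)
_∈?_ = DecMembership._∈?_ _≟_

𝟙 : {P : Set ℓ} → Dec P → ℕ
𝟙 (yes _) = 1
𝟙 (no _)  = 0

𝟙-yes : {P : Set ℓ} (P? : Dec P) → P → 𝟙 P? ≡ 1
𝟙-yes (yes _) _  = refl
𝟙-yes (no ¬p) p = contradiction p ¬p

𝟙-no : {P : Set ℓ} (P? : Dec P) → ¬ P → 𝟙 P? ≡ 0
𝟙-no (yes p) ¬p = contradiction p ¬p
𝟙-no (no _)  _  = refl

𝟙-cong : {P Q : Set ℓ} (P? : Dec P) (Q? : Dec Q) → (P → Q) → (Q → P) → 𝟙 P? ≡ 𝟙 Q?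
𝟙-cong (yes p) Q? to _    = sym (𝟙-yes Q? (to p))
𝟙-cong (no ¬p) Q? _  from = sym (𝟙-no Q? (¬p ∘ from))

length-filter-∷ : {A : Set ℓ} {P : Pred A ℓ′} (P? : Decidable P) (x : A) (xs : List A) →
                  length (filter P? (x ∷ xs)) ≡ 𝟙 (P? x) + length (filter P? xs)
length-filter-∷ P? x xs with P? x
... | yes _ = refl
... | no _  = refl

∑ : ∀ n → (F₂^ n → ℕ) → ℕ
∑ zero    f = f []
∑ (suc n) f = ∑ n (f ∘ (false ∷_)) + ∑ n (f ∘ (true ∷_))

∑-cong : ∀ n {f g : F₂^ n → ℕ} → (∀ v → f v ≡ g v) → ∑ n f ≡ ∑ n g
∑-cong zero    f≗g = f≗g []
∑-cong (suc n) f≗g = cong₂ _+_ (∑-cong n (f≗g ∘ (false ∷_))) (∑-cong n (f≗g ∘ (true ∷_)))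

∑-0 : ∀ n → ∑ n (λ _ → 0) ≡ 0
∑-0 zero    = refl
∑-0 (suc n) = cong₂ _+_ (∑-0 n) (∑-0 n)

∑-distrib-+ : ∀ n (f g : F₂^ n → ℕ) → ∑ n (λ v → f v + g v) ≡ ∑ n f + ∑ n g
∑-distrib-+ zero    f g = refl
∑-distrib-+ (suc n) f g = begin
  ∑ n (λ v → f (false ∷ v) + g (false ∷ v)) + ∑ n (λ v → f (true ∷ v) + g (true ∷ v))
    ≡⟨ cong₂ _+_ (∑-distrib-+ n _ _) (∑-distrib-+ n _ _) ⟩
  (∑ n (f ∘ (false ∷_)) + ∑ n (g ∘ (false ∷_))) + (∑ n (f ∘ (true ∷_)) + ∑ n (g ∘ (true ∷_)))
    ≡⟨ +-interchange (∑ n (f ∘ (false ∷_))) _ _ _ ⟩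
  ∑ (suc n) f + ∑ (suc n) g ∎
  where open ≡-Reasoning

∑-translate : ∀ n (c : F₂^ n) (f : F₂^ n → ℕ) → ∑ n (f ∘ (c ⊕_)) ≡ ∑ n f
∑-translate zero    []          f = refl
∑-translate (suc n) (false ∷ c) f =
  cong₂ _+_ (∑-translate n c (f ∘ (false ∷_))) (∑-translate n c (f ∘ (true ∷_)))
∑-translate (suc n) (true ∷ c)  f =
  trans (cong₂ _+_ (∑-translate n c (f ∘ (true ∷_))) (∑-translate n c (f ∘ (false ∷_))))
        (ℕ.+-comm (∑ n (f ∘ (true ∷_))) _)

∑-𝟙-≡ : ∀ n (x : F₂^ n) → ∑ n (λ v → 𝟙 (v ≟ x)) ≡ 1
∑-𝟙-≡ zero    []      = refl
∑-𝟙-≡ (suc n) (b ∷ x) = trans (cong₂ _+_ (first-bit false) (first-bit true)) (exactly-one b)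
  where
  first-bit : ∀ b′ → ∑ n (λ v → 𝟙 ((b′ ∷ v) ≟ (b ∷ x))) ≡ 𝟙 (b′ Bool.≟ b)
  first-bit b′ with b′ Bool.≟ b
  ... | yes refl = trans (∑-cong n (λ v → 𝟙-cong _ (v ≟ x) Vec.∷-injectiveʳ (cong (b ∷_))))
                         (∑-𝟙-≡ n x)
  -- each summand now computes to 𝟙 (no _)
  ... | no _     = ∑-0 n
  exactly-one : ∀ b → 𝟙 (false Bool.≟ b) + 𝟙 (true Bool.≟ b) ≡ 1
  exactly-one false = refl
  exactly-one true  = refl

𝟙-∈-∷ : ∀ {x : F₂^ n} {S} → x ∉ S → ∀ v → 𝟙 (v ∈? (x ∷ S)) ≡ 𝟙 (v ≟ x) + 𝟙 (v ∈? S)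
𝟙-∈-∷ {x = x} {S} x∉S v with v ≟ x
... | yes refl = cong suc (sym (𝟙-no (v ∈? S) x∉S))
... | no v≢x   = 𝟙-cong _ (v ∈? S) (tail v≢x) there

∑-𝟙-∈ : ∀ n (S : List (F₂^ n)) → Unique S → ∑ n (λ v → 𝟙 (v ∈? S)) ≡ length S
∑-𝟙-∈ n []      _                = ∑-0 n
∑-𝟙-∈ n (x ∷ S) (x≢S ∷ S-unique) = begin
  ∑ n (λ v → 𝟙 (v ∈? (x ∷ S)))                    ≡⟨ ∑-cong n (𝟙-∈-∷ (All¬⇒¬Any x≢S)) ⟩
  ∑ n (λ v → 𝟙 (v ≟ x) + 𝟙 (v ∈? S))              ≡⟨ ∑-distrib-+ n _ _ ⟩
  ∑ n (λ v → 𝟙 (v ≟ x)) + ∑ n (λ v → 𝟙 (v ∈? S)) ≡⟨ cong₂ _+_ (∑-𝟙-≡ n x) (∑-𝟙-∈ n S S-unique) ⟩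
  suc (length S)                                  ∎
  where open ≡-Reasoning

∑-length-filter-translate : ∀ n {P : Pred (F₂^ n) ℓ} (P? : Decidable P) (cs : List (F₂^ n)) →
  ∑ n (λ a → length (filter (λ c → P? (c ⊕ a)) cs)) ≡ length cs ℕ.* ∑ n (𝟙 ∘ P?)
∑-length-filter-translate n P? []       = ∑-0 n
∑-length-filter-translate n P? (c ∷ cs) = begin
  ∑ n (λ a → length (filter (λ c → P? (c ⊕ a)) (c ∷ cs)))
    ≡⟨ ∑-cong n (λ a → length-filter-∷ (λ c → P? (c ⊕ a)) c cs) ⟩
  ∑ n (λ a → 𝟙 (P? (c ⊕ a)) + length (filter (λ c → P? (c ⊕ a)) cs))
    ≡⟨ ∑-distrib-+ n _ _ ⟩
  ∑ n (λ a → 𝟙 (P? (c ⊕ a))) + ∑ n (λ a → length (filter (λ c → P? (c ⊕ a)) cs))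
    ≡⟨ cong₂ _+_ (∑-translate n c (𝟙 ∘ P?)) (∑-length-filter-translate n P? cs) ⟩
  ∑ n (𝟙 ∘ P?) + length cs ℕ.* ∑ n (𝟙 ∘ P?) ∎
  where open ≡-Reasoning

+-≤-2* : ∀ k {x y u v m} → x ℕ.≤ k ℕ.* u → y ℕ.≤ k ℕ.* v → u ℕ.≤ m → v ℕ.≤ m →
         x + y ℕ.≤ 2 ℕ.* k ℕ.* m
+-≤-2* k {x} {y} {u} {v} {m} x≤ku y≤kv u≤m v≤m = begin
  x + y                ≤⟨ ℕ.+-mono-≤ x≤ku y≤kv ⟩
  k ℕ.* u + k ℕ.* v    ≤⟨ ℕ.+-mono-≤ (ℕ.*-monoʳ-≤ k u≤m) (ℕ.*-monoʳ-≤ k v≤m) ⟩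
  k ℕ.* m + k ℕ.* m    ≡⟨ double k m ⟩
  2 ℕ.* k ℕ.* m        ∎
  where
  open ℕ.≤-Reasoning
  double : ∀ k m → k ℕ.* m + k ℕ.* m ≡ 2 ℕ.* k ℕ.* m
  double = solve-∀

averaging : ∀ n (f : F₂^ n → ℕ) → ∃[ a ] ∑ n f ℕ.≤ 2 ^ n ℕ.* f a
averaging zero    f = [] , ℕ.≤-reflexive (sym (ℕ.+-identityʳ (f [])))
averaging (suc n) f
  with a₀ , ∑₀≤ ← averaging n (f ∘ (false ∷_))
     | a₁ , ∑₁≤ ← averaging n (f ∘ (true ∷_))
  with ℕ.≤-total (f (false ∷ a₀)) (f (true ∷ a₁))
... | inj₁ f₀≤f₁ = true ∷ a₁  , +-≤-2* (2 ^ n) ∑₀≤ ∑₁≤ f₀≤f₁ ℕ.≤-refl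
... | inj₂ f₁≤f₀ = false ∷ a₀ , +-≤-2* (2 ^ n) ∑₀≤ ∑₁≤ ℕ.≤-refl f₁≤f₀

replicate-false-≼ : ∀ (y : F₂^ n) → replicate n false ≼ y
replicate-false-≼ (b ∷ y) Fin.zero    = ≤-minimum b
replicate-false-≼ (b ∷ y) (Fin.suc i) = replicate-false-≼ y i

∷-≼ : ∀ b {x y : F₂^ n} → x ≼ y → (b ∷ x) ≼ (b ∷ y)
∷-≼ b x≼y Fin.zero    = Bool.b≤b
∷-≼ b x≼y (Fin.suc i) = x≼y i

IsChain-⊆ : {C D : List (F₂^ n)} → C ⊆ D → IsChain D → IsChain C
IsChain-⊆ C⊆D D-chain x∈C y∈C = D-chain (C⊆D x∈C) (C⊆D y∈C)

maximalChain : ∀ n → List (F₂^ n)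
maximalChain zero    = [] ∷ []
maximalChain (suc n) = replicate (suc n) false ∷ map (true ∷_) (maximalChain n)

length-maximalChain : ∀ n → length (maximalChain n) ≡ suc n
length-maximalChain zero    = refl
length-maximalChain (suc n) =
  cong suc (trans (length-map (true ∷_) (maximalChain n)) (length-maximalChain n))

maximalChain-unique : ∀ n → Unique (maximalChain n)
maximalChain-unique zero    = [] ∷ []
maximalChain-unique (suc n) =
  map⁺ (All.universal (λ _ ()) (maximalChain n)) ∷
  Unique.map⁺ Vec.∷-injectiveʳ (maximalChain-unique n)

maximalChain-isChain : ∀ n → IsChain (maximalChain n)
maximalChain-isChain zero    {[]} {[]} _ _ = inj₁ (λ ())
maximalChain-isChain (suc n) {y = y} (here refl) _           = inj₁ (replicate-false-≼ y)
maximalChain-isChain (suc n) {x}     (there _)   (here refl) = inj₂ (replicate-false-≼ x)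
maximalChain-isChain (suc n) (there x∈) (there y∈)
  with x′ , x′∈ , refl ← ∈-map⁻ (true ∷_) x∈
     | y′ , y′∈ , refl ← ∈-map⁻ (true ∷_) y∈
  with maximalChain-isChain n x′∈ y′∈
... | inj₁ x′≼y′ = inj₁ (∷-≼ true x′≼y′)
... | inj₂ y′≼x′ = inj₂ (∷-≼ true y′≼x′)

⊕-involutive : ∀ (c a : F₂^ n) → (c ⊕ a) ⊕ a ≡ c
⊕-involutive []      []      = refl
⊕-involutive (x ∷ c) (y ∷ a) = cong₂ _∷_ xor-involutive (⊕-involutive c a)
  where
  xor-involutive : (x xor y) xor y ≡ x
  xor-involutive = trans (xor-assoc x y y) (trans (cong (x xor_) (xor-same y)) (xor-identityʳ x))

∈Translate-⊕ : ∀ {S} {a c : F₂^ n} → (c ⊕ a) ∈ S → c ∈Translate S + a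
∈Translate-⊕ {a = a} {c} c⊕a∈S = c ⊕ a , c⊕a∈S , sym (⊕-involutive c a)

chainInTranslate : List (F₂^ n) → F₂^ n → List (F₂^ n)
chainInTranslate {n} S a = filter (λ c → (c ⊕ a) ∈? S) (maximalChain n)

∑-length-chainInTranslate : ∀ n (S : List (F₂^ n)) → Unique S →
                            ∑ n (length ∘ chainInTranslate S) ≡ suc n ℕ.* length S
∑-length-chainInTranslate n S S-unique = begin
  ∑ n (length ∘ chainInTranslate S)
    ≡⟨ ∑-length-filter-translate n (_∈? S) (maximalChain n) ⟩
  length (maximalChain n) ℕ.* ∑ n (λ v → 𝟙 (v ∈? S))
    ≡⟨ cong₂ ℕ._*_ (length-maximalChain n) (∑-𝟙-∈ n S S-unique) ⟩
  suc n ℕ.* length S ∎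
  where open ≡-Reasoning

translate-contains-long-chain : ∀ n (S : List (F₂^ n)) → Unique S →
  Σ (F₂^ n) λ a → Σ (List (F₂^ n)) λ C →
    Unique C × All (λ c → c ∈Translate S + a) C × IsChain C ×
    suc n ℕ.* length S ℕ.≤ 2 ^ n ℕ.* length C
translate-contains-long-chain n S S-unique with averaging n (length ∘ chainInTranslate S)
... | a , ∑≤ =
  a , chainInTranslate S a ,
  Unique.filter⁺ ∈S+a? (maximalChain-unique n) ,
  All.map ∈Translate-⊕ (all-filter ∈S+a? (maximalChain n)) ,
  IsChain-⊆ (filter-⊆ ∈S+a? (maximalChain n)) (maximalChain-isChain n) ,
  subst (ℕ._≤ 2 ^ n ℕ.* length (chainInTranslate S a))
        (∑-length-chainInTranslate n S S-unique) ∑≤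
  where
  ∈S+a? : ∀ c → Dec ((c ⊕ a) ∈ S)
  ∈S+a? c = (c ⊕ a) ∈? S

ℕtoℚ≡mkℚ : ∀ k → ℕtoℚ k ≡ mkℚ (+ k) 0 (Coprimality.sym (Coprimality.1-coprimeTo k))
ℕtoℚ≡mkℚ k = ℚ.normalize-coprime (Coprimality.sym (Coprimality.1-coprimeTo k))

ℕtoℚ-* : ∀ k m → ℕtoℚ k * ℕtoℚ m ≡ ℕtoℚ (k ℕ.* m)
ℕtoℚ-* k m rewrite ℕtoℚ≡mkℚ k | ℕtoℚ≡mkℚ m = cong (ℚ._/ 1) (sym (ℤ.pos-* k m))

ℕtoℚ-mono-≤ : ∀ {k m} → k ℕ.≤ m → ℕtoℚ k ≤ ℕtoℚ m
ℕtoℚ-mono-≤ {k} {m} k≤m rewrite ℕtoℚ≡mkℚ k | ℕtoℚ≡mkℚ m =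
  ℚ.*≤* (ℤ.*-monoʳ-≤-nonNeg (+ 1) (ℤ.+≤+ k≤m))

≤-rescale : ∀ α m r s k .{{_ : NonZero m}} →
            α * ℕtoℚ m ≤ ℕtoℚ s → r ℕ.* s ℕ.≤ m ℕ.* k → α * ℕtoℚ r ≤ ℕtoℚ k
≤-rescale α m r s k αm≤s rs≤mk = ℚ.*-cancelʳ-≤-pos (ℕtoℚ m) (begin
  α * ℕtoℚ r * ℕtoℚ m  ≡⟨ xy∙z≈xz∙y α (ℕtoℚ r) (ℕtoℚ m) ⟩
  α * ℕtoℚ m * ℕtoℚ r  ≤⟨ ℚ.*-monoʳ-≤-nonNeg (ℕtoℚ r) αm≤s ⟩
  ℕtoℚ s * ℕtoℚ r      ≡⟨ ℕtoℚ-* s r ⟩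
  ℕtoℚ (s ℕ.* r)       ≤⟨ ℕtoℚ-mono-≤ (subst₂ ℕ._≤_ (ℕ.*-comm r s) (ℕ.*-comm m k) rs≤mk) ⟩
  ℕtoℚ (k ℕ.* m)       ≡⟨ ℕtoℚ-* k m ⟨
  ℕtoℚ k * ℕtoℚ m      ∎)
  where
  open ℚ.≤-Reasoning
  instance
    m-positive : Positive (ℕtoℚ m)
    m-positive = ℚ.normalize-pos m 1
    r-nonNegative : NonNegative (ℕtoℚ r)
    r-nonNegative = ℚ.normalize-nonNeg r 1

lemma4p3 : (n : ℕ) (α : ℚ) → 0ℚ ≤ α → α ≤ 1ℚ →
    (S : List (F₂^ n)) → Unique S →
    α * ℕtoℚ (2 ^ n) ≤ ℕtoℚ (length S) →
    Σ (F₂^ n) λ a → Σ (List (F₂^ n)) λ C →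
      Unique C × All (λ c → c ∈Translate S + a) C × IsChain C ×
      α * ℕtoℚ n ≤ ℕtoℚ (length C)
lemma4p3 n α 0≤α _ S S-unique α2ⁿ≤|S| with translate-contains-long-chain n S S-unique
... | a , C , C-unique , C⊆S+a , C-chain , [n+1]|S|≤2ⁿ|C| =
  a , C , C-unique , C⊆S+a , C-chain , ℚ.≤-trans αn≤α[n+1] α[n+1]≤|C|
  where
  instance
    α-nonNegative : NonNegative α
    α-nonNegative = ℚ.nonNegative 0≤α
  αn≤α[n+1] : α * ℕtoℚ n ≤ α * ℕtoℚ (suc n)
  αn≤α[n+1] = ℚ.*-monoˡ-≤-nonNeg α (ℕtoℚ-mono-≤ (ℕ.n≤1+n n))
  α[n+1]≤|C| : α * ℕtoℚ (suc n) ≤ ℕtoℚ (length C)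
  α[n+1]≤|C| = ≤-rescale α (2 ^ n) (suc n) (length S) (length C) {{ℕ.m^n≢0 2 n}}
                          α2ⁿ≤|S| [n+1]|S|≤2ⁿ|C|
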